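{- For every integer $p>0$, the map $\mathrm{C}_{|p}$ from FDDSs to FDDSs is a semiring endomorphism: $\mathrm{C}_{|p}(\mathbf{0})=\mathbf{0}$, $\mathrm{C}_{|p}(\mathbf{1})=\mathbf{1}$, $\mathrm{C}_{|p}(A+B)=\mathrm{C}_{|p}(A)+\mathrm{C}_{|p}(B)$ and $\mathrm{C}_{|p}(AB)=\mathrm{C}_{|p}(A)\,\mathrm{C}_{|p}(B)$ for all FDDSs $A,B$.
   Context: An FDDS is a finite set with a total function on it, viewed as a functional digraph up to isomorphism. Sum is disjoint union and product is the direct product of digraphs (vertex set $V(A)\times V(B)$, arc $(u,u')\to(v,v')$ iff $u\to v$ and $u'\to v'$); $\mathbf{0}$ is the empty FDDS and $\mathbf{1}$ the single fixed point. Each connected component has exactly one cycle. For $p>0$, $\mathrm{C}_{|p}(A)$ denotes the sub-FDDS of $A$ made of the connected components of $A$ whose cycle length divides $p$. -}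

module Defs where

open import Data.Nat using (ℕ; zero; suc; _+_; _*_; NonZero)
open import Data.Nat.Divisibility using (_∣_; _∣?_)
open import Data.Fin using (Fin; zero; suc)
open import Data.Fin.Properties using (_≟_)
open import Data.Empty using (⊥)
open import Data.Unit using (⊤)
open import Data.Sum using (_⊎_; inj₁; inj₂)
open import Data.Product using (Σ; _×_; _,_; proj₁; proj₂)
open import Data.Bool using (Bool; true; false; T; if_then_else_)
import Data.Bool.Properties
import Data.Product.Properties
import Relation.Nullary
import Relation.Nullary.Decidable
import Data.Empty
import Function
import Relation.Binary.PropositionalEquality
open import Function using (mk↔ₛ′)
open import Function using (_∘_; _↔_; Inverse)
open import Relation.Binary.PropositionalEquality using (_≡_; refl; cong; subst; sym)
open import Relation.Nullary using (does)
open import Level using (0ℓ)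

iter : {S : Set} → (S → S) → ℕ → S → S
iter f zero    x = x
iter f (suc k) x = f (iter f k x)

record FDDS : Set₁ where
  field
    State : Set
    size  : ℕ
    enum  : State ↔ Fin size
    step  : State → State
open FDDS public

_≅_ : FDDS → FDDS → Set
A ≅ B = Σ (State A ↔ State B) λ h →
          ∀ x → Inverse.to h (step A x) ≡ step B (Inverse.to h x)

𝟎 : FDDS
𝟎 = record { State = ⊥ ; size = 0 ; enum = emptyIso ; step = λ x → x }
  where
  emptyIso : ⊥ ↔ Fin 0
  emptyIso = record { to = λ () ; from = λ () ; to-cong = λ { {()} } ; from-cong = λ { {()} }
                    ; inverse = (λ { {()} }) , (λ { {()} }) }

𝟏 : FDDS
𝟏 = record { State = ⊤ ; size = 1 ; enum = oneIso ; step = λ x → x }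
  where
  open import Data.Fin using (zero)
  open import Relation.Binary.PropositionalEquality using (refl; cong)
  oneIso : ⊤ ↔ Fin 1
  oneIso = record { to = λ _ → zero ; from = λ _ → _ ; to-cong = λ _ → refl
                  ; from-cong = λ _ → refl
                  ; inverse = (λ { {zero} _ → refl }) , (λ _ → refl) }

_⊕_ : FDDS → FDDS → FDDS
A ⊕ B = record { State = State A ⊎ State B ; size = size A + size B
               ; enum = ↔-trans (⊎-cong (enum A) (enum B)) (↔-sym (+↔⊎ {size A} {size B}))
               ; step = λ { (inj₁ a) → inj₁ (step A a) ; (inj₂ b) → inj₂ (step B b) } }
  where
  open import Function.Properties.Inverse using (↔-trans; ↔-sym)
  open import Data.Sum.Function.Propositional using (_⊎-cong_)
  open import Data.Fin.Properties using (+↔⊎)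
  ⊎-cong = _⊎-cong_

_⊗_ : FDDS → FDDS → FDDS
A ⊗ B = record { State = State A × State B ; size = size A * size B
               ; enum = ↔-trans (×-cong (enum A) (enum B)) (↔-sym (*↔× {size A} {size B}))
               ; step = λ p → step A (proj₁ p) , step B (proj₂ p) }
  where
  open import Function.Properties.Inverse using (↔-trans; ↔-sym)
  open import Data.Product.Function.NonDependent.Propositional using (_×-cong_)
  open import Data.Fin.Properties using (*↔×)
  ×-cong = _×-cong_

_≟S_ : (A : FDDS) → State A → State A → Bool
_≟S_ A x y = does (Inverse.to (enum A) x ≟ Inverse.to (enum A) y)

-- the point reached after |A| steps: it lies on the cycle of x's component
cyclePoint : (A : FDDS) → State A → State A
cyclePoint A x = iter (step A) (size A) x

-- The cycle of the component containing x passes through cyclePoint A x.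
-- The length ℓ of that cycle divides p iff walking p steps from a point of
-- the cycle returns to that point (ℓ is the period of every cycle point).
inC : (p : ℕ) (A : FDDS) → State A → Bool
inC p A x = _≟S_ A (iter (step A) p (cyclePoint A x)) (cyclePoint A x)

count : {n : ℕ} → (Fin n → Bool) → ℕ
count {zero}  b = 0
count {suc n} b with b zero
... | true  = suc (count (λ i → b (suc i)))
... | false = count (λ i → b (suc i))

subsetEnum : {n : ℕ} (b : Fin n → Bool) → Σ (Fin n) (λ i → T (b i)) ↔ Fin (count b)
subsetEnum {zero} b = mk↔ₛ′ (λ { (() , _) }) (λ ()) (λ ()) (λ { (() , _) })
subsetEnum {suc n} b with b zero in eq
... | true = mk↔ₛ′ to from ti ft
  where
  r = subsetEnum (λ i → b (suc i))
  open Function.Inverse r renaming (to to rto; from to rfrom; strictlyInverseˡ to rl; strictlyInverseʳ to rr)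
  to : Σ (Fin (suc n)) (λ i → T (b i)) → Fin (suc (count (λ i → b (suc i))))
  to (zero , _) = zero
  to (suc i , t) = suc (rto (i , t))
  from : Fin (suc (count (λ i → b (suc i)))) → Σ (Fin (suc n)) (λ i → T (b i))
  from zero = zero , Data.Bool.Properties.T-≡ .Function.Equivalence.from eq
  from (suc k) with rfrom k
  ... | i , t = suc i , t
  ti : ∀ k → to (from k) ≡ k
  ti zero = refl
  ti (suc k) with rfrom k | rl k
  ... | i , t | e = cong suc e
  ft : ∀ x → from (to x) ≡ x
  ft (zero , t) = cong (zero ,_) (Data.Bool.Properties.T-irrelevant _ _)
  ft (suc i , t) with rfrom (rto (i , t)) | rr (i , t)
  ... | .(i , t) | refl = refl
... | false = mk↔ₛ′ to from ti ft
  where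
  r = subsetEnum (λ i → b (suc i))
  open Function.Inverse r renaming (to to rto; from to rfrom; strictlyInverseˡ to rl; strictlyInverseʳ to rr)
  to : Σ (Fin (suc n)) (λ i → T (b i)) → Fin (count (λ i → b (suc i)))
  to (zero , t) = Data.Empty.⊥-elim (Relation.Binary.PropositionalEquality.subst T eq t)
  to (suc i , t) = rto (i , t)
  from : Fin (count (λ i → b (suc i))) → Σ (Fin (suc n)) (λ i → T (b i))
  from k with rfrom k
  ... | i , t = suc i , t
  ti : ∀ k → to (from k) ≡ k
  ti k with rfrom k | rl k
  ... | i , t | e = e
  ft : ∀ x → from (to x) ≡ x
  ft (zero , t) = Data.Empty.⊥-elim (Relation.Binary.PropositionalEquality.subst T eq t)
  ft (suc i , t) with rfrom (rto (i , t)) | rr (i , t)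
  ... | .(i , t) | refl = refl

-- C_{|p}(A): the sub-FDDS of A made of the connected components whose cycle
-- length divides p.  (Membership is constant on components, so the set is
-- closed under step.)
C∣ : (p : ℕ) → FDDS → FDDS
C∣ p A = record
  { State = Σ (State A) (λ x → T (inC p A x))
  ; size  = count b
  ; enum  = ↔-trans e (subsetEnum b)
  ; step  = λ { (x , t) → step A x , stepClosed x t }
  }
  where
  open import Function.Properties.Inverse using (↔-trans)
  module E = Inverse (enum A)
  b : Fin (size A) → Bool
  b i = inC p A (E.from i)
  fix : ∀ x → T (inC p A x) → T (b (E.to x))
  fix x t = subst (λ y → T (inC p A y)) (sym (E.strictlyInverseʳ x)) t
  e : Σ (State A) (λ x → T (inC p A x)) ↔ Σ (Fin (size A)) (λ i → T (b i))
  e = mk↔ₛ′ (λ { (x , t) → E.to x , fix x t })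
            (λ { (i , t) → E.from i , t })
            (λ { (i , t) → lemTo i t })
            (λ { (x , t) → lemFrom x t })
    where
    lemTo : ∀ i t → (E.to (E.from i) , fix (E.from i) t) ≡ (i , t)
    lemTo i t = Data.Product.Properties.Σ-≡,≡→≡ (E.strictlyInverseˡ i , Data.Bool.Properties.T-irrelevant _ _)
    lemFrom : ∀ x t → (E.from (E.to x) , fix x t) ≡ (x , t)
    lemFrom x t = Data.Product.Properties.Σ-≡,≡→≡ (E.strictlyInverseʳ x , Data.Bool.Properties.T-irrelevant _ _)
  f = step A
  iter-comm : ∀ k y → iter f k (f y) ≡ f (iter f k y)
  iter-comm zero y = refl
  iter-comm (suc k) y = cong f (iter-comm k y)
  stepClosed : ∀ x → T (inC p A x) → T (inC p A (f x))
  stepClosed x t = Data.Bool.Properties.T-≡ .Function.Equivalence.from (dec-true (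
      Relation.Binary.PropositionalEquality.trans (cong (Inverse.to (enum A)) q)
        (cong (Inverse.to (enum A)) (sym (iter-comm (size A) x)))))
    where
    y = cyclePoint A x
    wit : ∀ {P : Set} (d : Relation.Nullary.Dec P) → T (does d) → P
    wit (Relation.Nullary.yes pr) _ = pr
    dec-true : ∀ {a c : Fin (size A)} → a ≡ c → does (a ≟ c) ≡ true
    dec-true {a} {c} e with a ≟ c
    ... | Relation.Nullary.yes _ = refl
    ... | Relation.Nullary.no ne = Data.Empty.⊥-elim (ne e)
    y≡ : iter f p y ≡ y
    y≡ = Relation.Binary.PropositionalEquality.trans (sym (E.strictlyInverseʳ _))
           (Relation.Binary.PropositionalEquality.trans (cong E.from (wit (E.to (iter f p y) ≟ E.to y) t)) (E.strictlyInverseʳ _))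
    q : iter f p (cyclePoint A (f x)) ≡ f y
    q = Relation.Binary.PropositionalEquality.trans
          (cong (iter f p) (iter-comm (size A) x))
          (Relation.Binary.PropositionalEquality.trans (iter-comm p y) (cong f y≡))

{-# OPTIONS --safe #-}
module Submission where

-- Call x eventually p-periodic when some iterate y = fᵏ x satisfies fᵖ y = y.  The test
-- inC p A x, which inspects the particular iterate f^|A| x, holds iff x is eventually
-- p-periodic: f^|A| x lies on a cycle (pigeonhole), and every later iterate of x returns to
-- it, so p-periodicity of any fᵏ x passes on to f^|A| x.  Unlike inC, eventual
-- p-periodicity does not mention |A|: it is preserved and reflected by injective morphisms
-- such as the inclusions into a sum, and holds in a product iff it holds in both factors
-- (wait long enough for both).  The isomorphisms are then the evident bijections.

open import Defs
open import Data.Nat using (ℕ; zero; suc; _+_; _*_; _<_)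
open import Data.Nat.Properties using (+-comm; *-suc; ≤-pred; n<1+n; m≤n⇒∃[o]m+o≡n)
open import Data.Fin using (toℕ)
open import Data.Fin.Properties using (pigeonhole; toℕ<n; _≟_)
open import Data.Product using (Σ; ∃-syntax; _×_; _,_; proj₁; proj₂; map)
open import Data.Product.Function.NonDependent.Propositional using (_×-⇔_)
open import Data.Sum using (inj₁; inj₂)
open import Data.Sum.Properties using (inj₁-injective; inj₂-injective)
open import Data.Bool using (Bool; T)
open import Data.Bool.Properties using (T-irrelevant)
open import Data.Unit using (tt)
open import Relation.Nullary using (yes; no)
open import Relation.Binary.PropositionalEquality
open import Function using (Inverse; Injection; _⇔_; mk⇔; Equivalence; mk↔ₛ′)
open import Function.Definitions using (Injective)
open import Function.Properties.Inverse using (↔⇒↣)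
open import Function.Construct.Symmetry using (⇔-sym)
open import Function.Related.Propositional using (module EquationalReasoning)

Periodic : {S : Set} → (S → S) → ℕ → S → Set
Periodic f p y = iter f p y ≡ y

EventuallyPeriodic : {S : Set} → (S → S) → ℕ → S → Set
EventuallyPeriodic f p x = ∃[ k ] Periodic f p (iter f k x)

module _ {S : Set} (f : S → S) where

  iter-+ : ∀ m n x → iter f (m + n) x ≡ iter f m (iter f n x)
  iter-+ zero    n x = refl
  iter-+ (suc m) n x = cong f (iter-+ m n x)

  iter-comm : ∀ m n x → iter f m (iter f n x) ≡ iter f n (iter f m x)
  iter-comm m n x = begin
    iter f m (iter f n x) ≡⟨ iter-+ m n x ⟨
    iter f (m + n) x      ≡⟨ cong (λ k → iter f k x) (+-comm m n) ⟩
    iter f (n + m) x      ≡⟨ iter-+ n m x ⟩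
    iter f n (iter f m x) ∎
    where open ≡-Reasoning

  periodic-* : ∀ {m y} k → Periodic f m y → Periodic f (k * m) y
  periodic-* zero            fixed = refl
  periodic-* {m} {y} (suc k) fixed = begin
    iter f (m + k * m) y        ≡⟨ iter-+ m (k * m) y ⟩
    iter f m (iter f (k * m) y) ≡⟨ cong (iter f m) (periodic-* k fixed) ⟩
    iter f m y                  ≡⟨ fixed ⟩
    y                           ∎
    where open ≡-Reasoning

  periodic-iter : ∀ p j {y} → Periodic f p y → Periodic f p (iter f j y)
  periodic-iter p j {y} fixed = trans (iter-comm p j y) (cong (iter f j) fixed)

  periodic-iter-+ : ∀ p j {x k} →
    Periodic f p (iter f k x) → Periodic f p (iter f (j + k) x)
  periodic-iter-+ p j {x} {k} fixed =
    subst (Periodic f p) (sym (iter-+ j k x)) (periodic-iter p j fixed)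

module _ {S T : Set} {f : S → S} {g : T → T}
         (h : S → T) (h-comm : ∀ x → h (f x) ≡ g (h x)) where

  iter-natural : ∀ k x → h (iter f k x) ≡ iter g k (h x)
  iter-natural zero    x = refl
  iter-natural (suc k) x = trans (h-comm (iter f k x)) (cong g (iter-natural k x))

  eventuallyPeriodic-map : ∀ p {x} → EventuallyPeriodic f p x → EventuallyPeriodic g p (h x)
  eventuallyPeriodic-map p {x} (k , fixed) = k , (begin
    iter g p (iter g k (h x)) ≡⟨ cong (iter g p) (iter-natural k x) ⟨
    iter g p (h (iter f k x)) ≡⟨ iter-natural p (iter f k x) ⟨
    h (iter f p (iter f k x)) ≡⟨ cong h fixed ⟩
    h (iter f k x)            ≡⟨ iter-natural k x ⟩
    iter g k (h x)            ∎)
    where open ≡-Reasoning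

  eventuallyPeriodic-reflect : Injective _≡_ _≡_ h →
    ∀ p {x} → EventuallyPeriodic g p (h x) → EventuallyPeriodic f p x
  eventuallyPeriodic-reflect h-inj p {x} (k , fixed) = k , h-inj (begin
    h (iter f p (iter f k x)) ≡⟨ iter-natural p (iter f k x) ⟩
    iter g p (h (iter f k x)) ≡⟨ cong (iter g p) (iter-natural k x) ⟩
    iter g p (iter g k (h x)) ≡⟨ fixed ⟩
    iter g k (h x)            ≡⟨ iter-natural k x ⟨
    h (iter f k x)            ∎)
    where open ≡-Reasoning

module _ {S T : Set} {f : S → S} {g : T → T} where

  iter-map : ∀ k x y → iter (map f g) k (x , y) ≡ (iter f k x , iter g k y)
  iter-map zero    x y = refl
  iter-map (suc k) x y = cong (map f g) (iter-map k x y)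

  eventuallyPeriodic-× : ∀ p {x y} →
    EventuallyPeriodic (map f g) p (x , y) ⇔
    (EventuallyPeriodic f p x × EventuallyPeriodic g p y)
  eventuallyPeriodic-× p {x} {y} = mk⇔
    (λ ep → eventuallyPeriodic-map proj₁ (λ _ → refl) p ep ,
            eventuallyPeriodic-map proj₂ (λ _ → refl) p ep)
    joint
    where
    joint : EventuallyPeriodic f p x × EventuallyPeriodic g p y →
            EventuallyPeriodic (map f g) p (x , y)
    joint ((k , fx) , (l , fy)) = l + k , (begin
      iter (map f g) p (iter (map f g) (l + k) (x , y))
        ≡⟨ cong (iter (map f g) p) (iter-map (l + k) x y) ⟩
      iter (map f g) p (iter f (l + k) x , iter g (l + k) y)
        ≡⟨ iter-map p _ _ ⟩
      (iter f p (iter f (l + k) x) , iter g p (iter g (l + k) y))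
        ≡⟨ cong₂ _,_ (periodic-iter-+ f p l fx) fy′ ⟩
      (iter f (l + k) x , iter g (l + k) y)
        ≡⟨ iter-map (l + k) x y ⟨
      iter (map f g) (l + k) (x , y) ∎)
      where
      open ≡-Reasoning
      fy′ : Periodic g p (iter g (l + k) y)
      fy′ = subst (λ n → Periodic g p (iter g n y)) (+-comm k l) (periodic-iter-+ g p k fy)

module _ (A : FDDS) where

  private
    f : State A → State A
    f = step A
    n : ℕ
    n = size A
    module E = Inverse (enum A)

    enum-injective : Injective _≡_ _≡_ E.to
    enum-injective = Injection.injective (↔⇒↣ (enum A))

  T-≟S : ∀ {x y} → T (_≟S_ A x y) ⇔ (x ≡ y)
  T-≟S {x} {y} with E.to x ≟ E.to y
  ... | yes same-image = mk⇔ (λ _ → enum-injective same-image) (λ _ → tt)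
  ... | no  different  = mk⇔ (λ ()) (λ x≡y → different (cong E.to x≡y))

  cyclePoint-periodic : ∀ x → ∃[ m ] Periodic f (suc m) (cyclePoint A x)
  cyclePoint-periodic x with pigeonhole (n<1+n n) (λ i → E.to (iter f (toℕ i) x))
  ... | i , j , i<j , same-image
      with m≤n⇒∃[o]m+o≡n i<j | m≤n⇒∃[o]m+o≡n (≤-pred (toℕ<n i))
  ... | d , 1+i+d≡j | r , i+r≡n =
    d , subst (Periodic f (suc d)) (orbit r (toℕ i) n (trans (+-comm r (toℕ i)) i+r≡n))
              (periodic-iter f (suc d) r returns)
    where
    orbit : ∀ a b c → a + b ≡ c → iter f a (iter f b x) ≡ iter f c x
    orbit a b c a+b≡c = trans (sym (iter-+ f a b x)) (cong (λ k → iter f k x) a+b≡c)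
    returns : Periodic f (suc d) (iter f (toℕ i) x)
    returns = begin
      iter f (suc d) (iter f (toℕ i) x)
        ≡⟨ orbit (suc d) (toℕ i) (toℕ j)
                 (trans (cong suc (+-comm d (toℕ i))) 1+i+d≡j) ⟩
      iter f (toℕ j) x
        ≡⟨ enum-injective same-image ⟨
      iter f (toℕ i) x ∎
      where open ≡-Reasoning

  -- k * m + n steps from fᵏ x are k * suc m steps from y = fⁿ x, a multiple of its period.
  cyclePoint-reachable : ∀ x k → ∃[ j ] iter f j (iter f k x) ≡ cyclePoint A x
  cyclePoint-reachable x k with cyclePoint-periodic x
  ... | m , periodic = k * m + n , (begin
    iter f (k * m + n) (iter f k x)        ≡⟨ iter-+ f (k * m) n _ ⟩
    iter f (k * m) (iter f n (iter f k x)) ≡⟨ cong (iter f (k * m)) (iter-comm f n k x) ⟩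
    iter f (k * m) (iter f k y)            ≡⟨ iter-+ f (k * m) k y ⟨
    iter f (k * m + k) y                   ≡⟨ cong (λ l → iter f l y) k*m+k≡k*[1+m] ⟩
    iter f (k * suc m) y                   ≡⟨ periodic-* f k periodic ⟩
    y                                      ∎)
    where
    open ≡-Reasoning
    y : State A
    y = cyclePoint A x
    k*m+k≡k*[1+m] : k * m + k ≡ k * suc m
    k*m+k≡k*[1+m] = trans (+-comm (k * m) k) (sym (*-suc k m))

  inC⇔eventuallyPeriodic : ∀ p x → T (inC p A x) ⇔ EventuallyPeriodic f p x
  inC⇔eventuallyPeriodic p x = mk⇔
    (λ t → n , Equivalence.to T-≟S t)
    (λ { (k , fixed) → let j , reach = cyclePoint-reachable x k in
           Equivalence.from T-≟S (subst (Periodic f p) reach (periodic-iter f p j fixed)) })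

module _ {A B : FDDS} (h : State A → State B) (h-comm : ∀ x → h (step A x) ≡ step B (h x))
         (h-inj : Injective _≡_ _≡_ h) where

  inC-reflect : ∀ p x → T (inC p B (h x)) ⇔ T (inC p A x)
  inC-reflect p x = begin
    T (inC p B (h x))                   ∼⟨ inC⇔eventuallyPeriodic B p (h x) ⟩
    EventuallyPeriodic (step B) p (h x) ∼⟨ mk⇔ (eventuallyPeriodic-reflect h h-comm h-inj p)
                                               (eventuallyPeriodic-map h h-comm p) ⟩
    EventuallyPeriodic (step A) p x     ∼⟨ ⇔-sym (inC⇔eventuallyPeriodic A p x) ⟩
    T (inC p A x)                       ∎
    where open EquationalReasoning

inC-⊗ : ∀ p A B a b → T (inC p (A ⊗ B) (a , b)) ⇔ (T (inC p A a) × T (inC p B b))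
inC-⊗ p A B a b = begin
  T (inC p (A ⊗ B) (a , b))
    ∼⟨ inC⇔eventuallyPeriodic (A ⊗ B) p (a , b) ⟩
  EventuallyPeriodic (step (A ⊗ B)) p (a , b)
    ∼⟨ eventuallyPeriodic-× p ⟩
  (EventuallyPeriodic (step A) p a × EventuallyPeriodic (step B) p b)
    ∼⟨ ⇔-sym (inC⇔eventuallyPeriodic A p a) ×-⇔
       ⇔-sym (inC⇔eventuallyPeriodic B p b) ⟩
  (T (inC p A a) × T (inC p B b)) ∎
  where open EquationalReasoning

Σ-T-≡ : ∀ {X : Set} {b : X → Bool} {x : X} {s t : T (b x)} →
        _≡_ {A = Σ X (λ x → T (b x))} (x , s) (x , t)
Σ-T-≡ = cong (_ ,_) (T-irrelevant _ _)

C∣-𝟎 : ∀ p → C∣ p 𝟎 ≅ 𝟎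
C∣-𝟎 p = mk↔ₛ′ (λ { (() , _) }) (λ ()) (λ ()) (λ { (() , _) }) , λ { (() , _) }

C∣-𝟏 : ∀ p → C∣ p 𝟏 ≅ 𝟏
C∣-𝟏 p = mk↔ₛ′ proj₁ (_, tt) (λ _ → refl) (λ _ → Σ-T-≡) , λ _ → refl

module _ (p : ℕ) (A B : FDDS) where

  C∣-⊕ : C∣ p (A ⊕ B) ≅ (C∣ p A ⊕ C∣ p B)
  C∣-⊕ = mk↔ₛ′ to from to∘from from∘to , to-step
    where
    inC-inj₁ : ∀ a → T (inC p (A ⊕ B) (inj₁ a)) ⇔ T (inC p A a)
    inC-inj₁ = inC-reflect {A} {A ⊕ B} inj₁ (λ _ → refl) inj₁-injective p
    inC-inj₂ : ∀ b → T (inC p (A ⊕ B) (inj₂ b)) ⇔ T (inC p B b)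
    inC-inj₂ = inC-reflect {B} {A ⊕ B} inj₂ (λ _ → refl) inj₂-injective p
    to : State (C∣ p (A ⊕ B)) → State (C∣ p A ⊕ C∣ p B)
    to (inj₁ a , t) = inj₁ (a , Equivalence.to (inC-inj₁ a) t)
    to (inj₂ b , t) = inj₂ (b , Equivalence.to (inC-inj₂ b) t)
    from : State (C∣ p A ⊕ C∣ p B) → State (C∣ p (A ⊕ B))
    from (inj₁ (a , t)) = inj₁ a , Equivalence.from (inC-inj₁ a) t
    from (inj₂ (b , t)) = inj₂ b , Equivalence.from (inC-inj₂ b) t
    to∘from : ∀ x → to (from x) ≡ x
    to∘from (inj₁ _) = cong inj₁ Σ-T-≡
    to∘from (inj₂ _) = cong inj₂ Σ-T-≡
    from∘to : ∀ x → from (to x) ≡ x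
    from∘to (inj₁ _ , _) = Σ-T-≡
    from∘to (inj₂ _ , _) = Σ-T-≡
    to-step : ∀ x → to (step (C∣ p (A ⊕ B)) x) ≡ step (C∣ p A ⊕ C∣ p B) (to x)
    to-step (inj₁ _ , _) = cong inj₁ Σ-T-≡
    to-step (inj₂ _ , _) = cong inj₂ Σ-T-≡

  C∣-⊗ : C∣ p (A ⊗ B) ≅ (C∣ p A ⊗ C∣ p B)
  C∣-⊗ = mk↔ₛ′ to from to∘from from∘to , to-step
    where
    to : State (C∣ p (A ⊗ B)) → State (C∣ p A ⊗ C∣ p B)
    to ((a , b) , t) = let ta , tb = Equivalence.to (inC-⊗ p A B a b) t in (a , ta) , (b , tb)
    from : State (C∣ p A ⊗ C∣ p B) → State (C∣ p (A ⊗ B))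
    from ((a , ta) , (b , tb)) = (a , b) , Equivalence.from (inC-⊗ p A B a b) (ta , tb)
    to∘from : ∀ x → to (from x) ≡ x
    to∘from _ = cong₂ _,_ Σ-T-≡ Σ-T-≡
    from∘to : ∀ x → from (to x) ≡ x
    from∘to _ = Σ-T-≡
    to-step : ∀ x → to (step (C∣ p (A ⊗ B)) x) ≡ step (C∣ p A ⊗ C∣ p B) (to x)
    to-step _ = cong₂ _,_ Σ-T-≡ Σ-T-≡

lemma1 : (p : ℕ) → 0 < p →
    (C∣ p 𝟎 ≅ 𝟎) × (C∣ p 𝟏 ≅ 𝟏) ×
    (∀ A B → C∣ p (A ⊕ B) ≅ (C∣ p A ⊕ C∣ p B)) ×
    (∀ A B → C∣ p (A ⊗ B) ≅ (C∣ p A ⊗ C∣ p B))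
lemma1 p _ = C∣-𝟎 p , C∣-𝟏 p , C∣-⊕ p , C∣-⊗ p
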